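{- Let $G$ be a finite simple graph and $\alpha:V(G)\to\mathbb{N}$. If there is an edge $uv\in E(G)$ with $\alpha(u)+\alpha(v)\ge 3$, then $X_G^{\alpha}=_{2s}0$, i.e. $[s_\lambda]X_G^\alpha=0$ for every partition $\lambda$ with at most two parts.
   Context: $\mathbb{N}=\{0,1,2,\dots\}$. For $\alpha:V(G)\to\mathbb{N}$, a proper multicoloring of type $\alpha$ is a map $\kappa$ from $V(G)$ to finite subsets of the positive integers with $|\kappa(v)|=\alpha(v)$ and $\kappa(u)\cap\kappa(v)=\emptyset$ for every edge $uv$; $X_G^{\alpha}=\sum_\kappa \prod_i x_i^{a_i}$ over such $\kappa$, with $a_i=\#\{v:i\in\kappa(v)\}$. For symmetric functions $f,g$, $f=_{2s}g$ means $[s_\lambda](f-g)=0$ for all partitions $\lambda$ of length $\ell(\lambda)\le 2$, where $[s_\lambda]$ denotes the coefficient of the Schur function $s_\lambda$. -}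

module Defs where

open import Data.Nat using (ℕ; zero; suc; _+_; _∸_; _≤_; _<_; _≥_; _≡ᵇ_; _<ᵇ_; _⊓_)
open import Data.Bool using (Bool; true; false; _∧_; _∨_; not; if_then_else_)
open import Data.List using (List; []; _∷_; [_]; map; concatMap; foldr; length; upTo; allFin; zip; lookup; _++_)
open import Data.Bool.ListAction using (all; or)
open import Data.Nat.ListAction using (sum)
open import Data.List.Relation.Unary.All using (All)
open import Data.List.Relation.Unary.Linked using (Linked)
open import Data.Vec as Vec using (Vec; []; _∷_)
open import Data.Fin using (Fin; toℕ)
open import Data.Integer as ℤ using (ℤ)
open import Data.Product using (_×_; _,_)
open import Relation.Binary.PropositionalEquality using (_≡_)

record SimpleGraph (n : ℕ) : Set where
  field
    Adj    : Fin n → Fin n → Bool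
    sym    : ∀ u v → Adj u v ≡ Adj v u
    irrefl : ∀ v → Adj v v ≡ false
open SimpleGraph public

allVecs : {A : Set} → List A → (m : ℕ) → List (Vec A m)
allVecs xs zero    = [ [] ]
allVecs xs (suc m) = concatMap (λ x → map (x ∷_) (allVecs xs m)) xs

countB : {A : Set} → (A → Bool) → List A → ℕ
countB p []       = 0
countB p (x ∷ xs) = if p x then suc (countB p xs) else countB p xs

-- A monomial is given by an exponent list a = (a_1,…,a_k) (all later
-- exponents 0).  A multicoloring contributing to x^a only uses colors
-- 1..k; a subset of {1..k} is a Vec Bool k (position i ↔ color i+1).

size : ∀ {k} → Vec Bool k → ℕ
size s = countB (λ b → b) (Vec.toList s)

disjointB : ∀ {k} → Vec Bool k → Vec Bool k → Bool
disjointB s t = not (or (Vec.toList (Vec.zipWith _∧_ s t)))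

Multicol : ℕ → ℕ → Set
Multicol n k = Vec (Vec Bool k) n

properB : ∀ {n k} → SimpleGraph n → Multicol n k → Bool
properB {n} G κ =
  all (λ u → all (λ v → not (Adj G u v) ∨ disjointB (Vec.lookup κ u) (Vec.lookup κ v))
                  (allFin n))
      (allFin n)

hasTypeB : ∀ {n k} → (Fin n → ℕ) → Multicol n k → Bool
hasTypeB {n} α κ = all (λ v → size (Vec.lookup κ v) ≡ᵇ α v) (allFin n)

-- exponent of color i in κ is #{v : i ∈ κ(v)}
contentB : ∀ {n} (a : List ℕ) → Multicol n (length a) → Bool
contentB {n} a κ =
  all (λ i → countB (λ v → Vec.lookup (Vec.lookup κ v) i) (allFin n) ≡ᵇ lookup a i)
      (allFin (length a))

-- [x^a] X_G^α  = number of proper multicolorings of type α with content a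
coeffX : ∀ {n} → SimpleGraph n → (Fin n → ℕ) → List ℕ → ℕ
coeffX {n} G α a =
  countB (λ κ → properB G κ ∧ hasTypeB α κ ∧ contentB a κ)
         (allVecs (allVecs (true ∷ false ∷ []) (length a)) n)

IsPartition : List ℕ → Set
IsPartition lam = All (λ p → 1 ≤ p) lam × Linked _≥_ lam

-- partitions of n with all parts ≤ m (first argument is fuel, ≥ n suffices)
parts : ℕ → ℕ → ℕ → List (List ℕ)
parts _       zero    m = [ [] ]
parts zero    (suc n) m = []
parts (suc f) (suc n) m =
  concatMap (λ p → map (suc p ∷_) (parts f (n ∸ p) (suc p))) (upTo (suc n ⊓ m))

partitions : ℕ → List (List ℕ)
partitions d = parts d d d

-- Schur functions: [x^a] s_λ = number of semistandard Young tableaux of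
-- shape λ with content a (entries in {1..k}, k = length a; entry i ↔ Fin i).

fillings : (k : ℕ) → List ℕ → List (List (List (Fin k)))
fillings k []          = [ [] ]
fillings k (r ∷ shape) =
  concatMap (λ row → map (Vec.toList row ∷_) (fillings k shape)) (allVecs (allFin k) r)

rowWeakB : ∀ {k} → List (Fin k) → Bool
rowWeakB []           = true
rowWeakB (x ∷ [])     = true
-- x ≤ y  for consecutive entries
rowWeakB (x ∷ y ∷ xs) = (toℕ x <ᵇ suc (toℕ y)) ∧ rowWeakB (y ∷ xs)

colStrictB : ∀ {k} → List (List (Fin k)) → Bool
colStrictB []            = true
colStrictB (r ∷ [])      = true
colStrictB (r ∷ r' ∷ rs) =
  all (λ { (x , y) → toℕ x <ᵇ toℕ y }) (zip r r') ∧ colStrictB (r' ∷ rs)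

entries : ∀ {k} → List (List (Fin k)) → List (Fin k)
entries = foldr _++_ []

contentT : (a : List ℕ) → List (List (Fin (length a))) → Bool
contentT a T =
  all (λ i → countB (λ x → toℕ x ≡ᵇ toℕ i) (entries T) ≡ᵇ lookup a i)
      (allFin (length a))

isSSYTB : (a : List ℕ) → List (List (Fin (length a))) → Bool
isSSYTB a T = all rowWeakB T ∧ colStrictB T ∧ contentT a T

kostka : List ℕ → List ℕ → ℕ
kostka lam a = countB (isSSYTB a) (fillings (length a) lam)

-- A homogeneous-of-degree-d symmetric function f is given
-- by its monomial coefficients f a = [x^a] f.  c is its Schur expansion
-- (c λ = [s_λ] f) iff f = Σ_λ c_λ s_λ, i.e. every monomial coefficient agrees.

sumℤ : List ℤ → ℤ
sumℤ = foldr ℤ._+_ (ℤ.+ 0)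

IsSchurExpansion : (List ℕ → ℕ) → (List ℕ → ℤ) → Set
IsSchurExpansion f c =
  ∀ (a : List ℕ) →
    ℤ.+ (f a) ≡ sumℤ (map (λ lam → c lam ℤ.* ℤ.+ (kostka lam a)) (partitions (sum a)))

-- Along an edge uv the colour sets κ(u) and κ(v) are disjoint, so a proper multicolouring of
-- type α needs at least α(u) + α(v) ≥ 3 colours: every monomial of X_G^α in at most two
-- variables has coefficient 0.  For a content (p, q) with q ≤ p the Kostka number K_{μ,(p,q)}
-- is 1 for a one-row μ, [μ₂ ≤ q] for a two-row μ and 0 otherwise, so these vanishing
-- coefficients give linear equations Σ_μ c_μ K_{μ,(p,q)} = 0.  The content (k, 0) isolates
-- c_(k), and subtracting the equation for (p + 2, j) from the one for (p + 1, j + 1) leaves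
-- exactly c_(p+1, j+1).

module Submission where

open import Defs hiding (sym)
open import Data.Bool using (Bool; true; false; _∧_; _∨_; not; if_then_else_; T)
open import Data.Bool.Properties using (∧-conicalˡ; ∧-conicalʳ; ∧-zeroʳ)
open import Data.Bool.ListAction using (all)
open import Data.Empty using (⊥; ⊥-elim)
open import Data.Fin as Fin using (Fin; toℕ)
open import Data.Integer as ℤ using (ℤ; 0ℤ)
import Data.Integer.Properties as ℤ
open import Algebra.Properties.CommutativeSemigroup ℤ.+-commutativeSemigroup using (interchange)
open import Data.List using (List; []; _∷_; map; concatMap; length; allFin; _++_; replicate; upTo)
open import Data.List.Membership.Propositional using (_∈_; find; lose)
open import Data.List.Membership.Propositional.Properties
  using (∈-allFin; ∈-concatMap⁻; ∈-concatMap⁺; ∈-map⁻; ∈-map⁺; ∈-upTo⁻; ∈-upTo⁺)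
open import Data.List.Properties
  using ( map-++; map-cong; map-∘; length-++; length-replicate
        ; ∷-injectiveˡ; ∷-injectiveʳ; ++-identityʳ; ≡-dec)
open import Data.List.Relation.Unary.All using (All; []; _∷_)
open import Data.List.Relation.Unary.Any using (here; there)
open import Data.List.Relation.Unary.Linked as Linked using (Linked; []; [-]; _∷_)
open import Data.Nat
  using (ℕ; zero; suc; _+_; _∸_; _≤_; _≥_; _<_; z≤n; s≤s; s≤s⁻¹; _⊓_; _≡ᵇ_; _≤ᵇ_; _<ᵇ_)
open import Data.Nat.ListAction using (sum)
open import Data.Nat.ListAction.Properties using (sum-++)
open import Data.Nat.Properties
open import Data.Product using (Σ; ∃₂; _×_; _,_; proj₁; proj₂)
open import Data.Sum as Sum using (_⊎_; inj₁; inj₂; [_,_]′)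
open import Data.Vec as Vec using (Vec; []; _∷_)
open import Data.Vec.Properties using (length-toList)
open import Function using (_∘_; id)
open import Relation.Nullary using (¬_; Dec; yes; no; contradiction)
open import Relation.Binary.PropositionalEquality

private variable
  A B : Set

∧-true⁻ : ∀ {x y} → x ∧ y ≡ true → x ≡ true × y ≡ true
∧-true⁻ {x} {y} h = ∧-conicalˡ x y h , ∧-conicalʳ x y h

∧-true⁺ : ∀ {x y} → x ≡ true → y ≡ true → x ∧ y ≡ true
∧-true⁺ refl refl = refl

all-true-∈ : (p : A → Bool) {xs : List A} {x : A} → all p xs ≡ true → x ∈ xs → p x ≡ true
all-true-∈ p {y ∷ _} h (here refl) = ∧-conicalˡ (p y) _ h
all-true-∈ p {y ∷ _} h (there x∈) = all-true-∈ p (∧-conicalʳ (p y) _ h) x∈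

≡ᵇ-true⇒≡ : ∀ {m n} → (m ≡ᵇ n) ≡ true → m ≡ n
≡ᵇ-true⇒≡ {m} {n} h = ≡ᵇ⇒≡ m n (subst T (sym h) _)

≡ᵇ-refl : ∀ n → (n ≡ᵇ n) ≡ true
≡ᵇ-refl zero    = refl
≡ᵇ-refl (suc n) = ≡ᵇ-refl n

countB-++ : (p : A → Bool) (xs ys : List A) → countB p (xs ++ ys) ≡ countB p xs + countB p ys
countB-++ p []       ys = refl
countB-++ p (x ∷ xs) ys with p x
... | true  = cong suc (countB-++ p xs ys)
... | false = countB-++ p xs ys

countB-map : (p : B → Bool) (f : A → B) (xs : List A) → countB p (map f xs) ≡ countB (p ∘ f) xs
countB-map p f []       = refl
countB-map p f (x ∷ xs) with p (f x)
... | true  = cong suc (countB-map p f xs)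
... | false = countB-map p f xs

countB-concatMap : (p : B → Bool) (f : A → List B) (xs : List A) →
  countB p (concatMap f xs) ≡ sum (map (countB p ∘ f) xs)
countB-concatMap p f []       = refl
countB-concatMap p f (x ∷ xs) =
  trans (countB-++ p (f x) (concatMap f xs)) (cong (countB p (f x) +_) (countB-concatMap p f xs))

countB-≡0 : (p : A → Bool) (xs : List A) → (∀ x → p x ≡ false) → countB p xs ≡ 0
countB-≡0 p []       _     = refl
countB-≡0 p (x ∷ xs) never rewrite never x = countB-≡0 p xs never

sum-map-≡0 : (g : A → ℕ) (xs : List A) → (∀ x → g x ≡ 0) → sum (map g xs) ≡ 0
sum-map-≡0 g []       _  = refl
sum-map-≡0 g (x ∷ xs) g≡0 rewrite g≡0 x = sum-map-≡0 g xs g≡0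

sum-map-concatMap : (g : B → ℕ) (f : A → List B) (xs : List A) →
  sum (map g (concatMap f xs)) ≡ sum (map (λ x → sum (map g (f x))) xs)
sum-map-concatMap g f []       = refl
sum-map-concatMap g f (x ∷ xs) = begin
  sum (map g (f x ++ concatMap f xs))          ≡⟨ cong sum (map-++ g (f x) _) ⟩
  sum (map g (f x) ++ map g (concatMap f xs))  ≡⟨ sum-++ (map g (f x)) _ ⟩
  sum (map g (f x)) + sum (map g (concatMap f xs))
    ≡⟨ cong (sum (map g (f x)) +_) (sum-map-concatMap g f xs) ⟩
  sum (map g (f x)) + sum (map (λ y → sum (map g (f y))) xs)  ∎
  where open ≡-Reasoning

∈⇒≤sum : ∀ {n ns} → n ∈ ns → n ≤ sum ns
∈⇒≤sum              (here refl)  = m≤m+n _ _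
∈⇒≤sum {ns = m ∷ _} (there n∈ns) = ≤-trans (∈⇒≤sum n∈ns) (m≤n+m _ m)

⟦_⟧ : Bool → ℕ
⟦ b ⟧ = if b then 1 else 0

⟦⟧≡0⊎ : ∀ {Q : Set} b → (b ≡ true → Q) → ⟦ b ⟧ ≡ 0 ⊎ Q
⟦⟧≡0⊎ false _ = inj₁ refl
⟦⟧≡0⊎ true  h = inj₂ (h refl)

⟦⟧≡0 : ∀ b → (b ≡ true → ⊥) → ⟦ b ⟧ ≡ 0
⟦⟧≡0 false _  = refl
⟦⟧≡0 true  ¬b = ⊥-elim (¬b refl)

⟦≤ᵇ⟧≡1 : ∀ {m n} → m ≤ n → ⟦ m ≤ᵇ n ⟧ ≡ 1
⟦≤ᵇ⟧≡1 {m} {n} m≤n with m ≤ᵇ n | ≤⇒≤ᵇ m≤n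
... | true | _ = refl

⟦≤ᵇ⟧≡0 : ∀ {m n} → ¬ m ≤ n → ⟦ m ≤ᵇ n ⟧ ≡ 0
⟦≤ᵇ⟧≡0 {m} {n} m≰n = ⟦⟧≡0 (m ≤ᵇ n) λ e → m≰n (≤ᵇ⇒≤ m n (subst T (sym e) _))

-- Proper multicolourings

size-disjoint : ∀ {k} (s t : Vec Bool k) → disjointB s t ≡ true → size s + size t ≤ k
size-disjoint         []          []          _  = z≤n
size-disjoint         (true  ∷ s) (true  ∷ t) ()
size-disjoint         (true  ∷ s) (false ∷ t) h  = s≤s (size-disjoint s t h)
size-disjoint {suc k} (false ∷ s) (true  ∷ t) h  =
  subst (_≤ suc k) (sym (+-suc (size s) (size t))) (s≤s (size-disjoint s t h))
size-disjoint         (false ∷ s) (false ∷ t) h  = m≤n⇒m≤1+n (size-disjoint s t h)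

module _ {n k : ℕ} (G : SimpleGraph n) (α : Fin n → ℕ) (κ : Multicol n k) where

  proper-disjoint : ∀ {u v} → properB G κ ≡ true → Adj G u v ≡ true →
    disjointB (Vec.lookup κ u) (Vec.lookup κ v) ≡ true
  proper-disjoint {u} {v} proper adj =
    subst (λ e → (not e ∨ disjointB (Vec.lookup κ u) (Vec.lookup κ v)) ≡ true) adj
      (all-true-∈ _ (all-true-∈ _ proper (∈-allFin u)) (∈-allFin v))

  hasType-size : hasTypeB α κ ≡ true → ∀ v → size (Vec.lookup κ v) ≡ α v
  hasType-size typed v = ≡ᵇ-true⇒≡ (all-true-∈ _ typed (∈-allFin v))

  proper-edge-colours : ∀ {u v} → Adj G u v ≡ true → properB G κ ≡ true → hasTypeB α κ ≡ true →
    α u + α v ≤ k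
  proper-edge-colours {u} {v} adj proper typed =
    subst (_≤ k) (cong₂ _+_ (hasType-size typed u) (hasType-size typed v))
      (size-disjoint (Vec.lookup κ u) (Vec.lookup κ v) (proper-disjoint proper adj))

coeffX-vanishes : ∀ {n} (G : SimpleGraph n) (α : Fin n → ℕ) {u v} → Adj G u v ≡ true →
  ∀ a → length a < α u + α v → coeffX G α a ≡ 0
coeffX-vanishes {n} G α adj a short =
  countB-≡0 _ (allVecs (allVecs (true ∷ false ∷ []) (length a)) n) rejected
  where
  rejected : ∀ κ → (properB G κ ∧ hasTypeB α κ ∧ contentB a κ) ≡ false
  rejected κ with properB G κ in proper | hasTypeB α κ in typed
  ... | false | _     = refl
  ... | true  | false = refl
  ... | true  | true  = ⊥-elim (<⇒≱ short (proper-edge-colours G α κ adj proper typed))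

-- Semistandard tableaux with two letters

Bit : Set
Bit = Fin 2

pattern b₀ = Fin.zero
pattern b₁ = Fin.suc Fin.zero

words : (r : ℕ) → List (Vec Bit r)
words r = allVecs (allFin 2) r

countB-fillings-∷ : ∀ {k} r shape (P : List (List (Fin k)) → Bool) →
  countB P (fillings k (r ∷ shape)) ≡
  sum (map (λ R → countB (P ∘ (Vec.toList R ∷_)) (fillings k shape)) (allVecs (allFin k) r))
countB-fillings-∷ {k} r shape P =
  trans (countB-concatMap P (λ R → map (Vec.toList R ∷_) (fillings k shape)) (allVecs (allFin k) r))
    (cong sum (map-cong (λ R → countB-map P (Vec.toList R ∷_) (fillings k shape))
                        (allVecs (allFin k) r)))

sum-bits-unique : ∀ b (F : Bit → ℕ) → F b ≡ 1 → (∀ b′ → b′ ≢ b → F b′ ≡ 0) →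
  sum (map F (allFin 2)) ≡ 1
sum-bits-unique b₀ F one other = cong₂ _+_ one (cong (_+ 0) (other b₁ λ ()))
sum-bits-unique b₁ F one other = cong₂ _+_ (other b₀ λ ()) (cong (_+ 0) one)

sum-words-unique : ∀ {r} (g : Vec Bit r → ℕ) (w : List Bit) → length w ≡ r →
  (∀ x → g x ≡ 0 ⊎ Vec.toList x ≡ w) → (∀ x → Vec.toList x ≡ w → g x ≡ 1) →
  sum (map g (words r)) ≡ 1
sum-words-unique {zero}  g []      _   _   at-w = cong (_+ 0) (at-w [] refl)
sum-words-unique {zero}  g (_ ∷ _) ()
sum-words-unique {suc r} g []      ()
sum-words-unique {suc r} g (b ∷ w) len off at-w =
  trans (sum-map-concatMap g (λ b′ → map (b′ ∷_) (words r)) (allFin 2))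
    (sum-bits-unique b _ starting-b other)
  where
  starting-b : sum (map g (map (b ∷_) (words r))) ≡ 1
  starting-b = trans (cong sum (sym (map-∘ (words r))))
    (sum-words-unique (g ∘ (b ∷_)) w (suc-injective len)
      (λ x → Sum.map₂ ∷-injectiveʳ (off (b ∷ x))) (λ x e → at-w (b ∷ x) (cong (b ∷_) e)))
  other : ∀ b′ → b′ ≢ b → sum (map g (map (b′ ∷_) (words r))) ≡ 0
  other b′ b′≢b = trans (cong sum (sym (map-∘ (words r))))
    (sum-map-≡0 _ (words r) λ x → [ id , (λ e → ⊥-elim (b′≢b (∷-injectiveˡ e))) ]′ (off (b′ ∷ x)))

row : ℕ → ℕ → List Bit
row a b = replicate a b₀ ++ replicate b b₁

length-row : ∀ a b → length (row a b) ≡ a + b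
length-row a b = trans (length-++ (replicate a b₀)) (cong₂ _+_ (length-replicate a) (length-replicate b))

rowWeak⇒row : ∀ L → rowWeakB L ≡ true → ∃₂ λ a b → L ≡ row a b
rowWeak⇒row []            _ = 0 , 0 , refl
rowWeak⇒row (b₀ ∷ [])     _ = 1 , 0 , refl
rowWeak⇒row (b₁ ∷ [])     _ = 0 , 1 , refl
rowWeak⇒row (x ∷ y ∷ L)   h with rowWeak⇒row (y ∷ L) (proj₂ (∧-true⁻ h))
rowWeak⇒row (b₀ ∷ y ∷ L)  h | a , b , e            = suc a , b , cong (b₀ ∷_) e
rowWeak⇒row (b₁ ∷ b₁ ∷ L) h | zero , b , e         = 0 , suc b , cong (b₁ ∷_) e
rowWeak⇒row (b₁ ∷ b₁ ∷ L) h | suc a , b , ()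
rowWeak⇒row (b₁ ∷ b₀ ∷ L) () | _

rowWeak-row : ∀ a b → rowWeakB (row a b) ≡ true
rowWeak-row zero          zero          = refl
rowWeak-row zero          (suc zero)    = refl
rowWeak-row zero          (suc (suc b)) = rowWeak-row zero (suc b)
rowWeak-row (suc zero)    zero          = refl
rowWeak-row (suc zero)    (suc b)       = rowWeak-row zero (suc b)
rowWeak-row (suc (suc a)) b             = rowWeak-row (suc a) b

count : Bit → List Bit → ℕ
count i = countB (λ x → toℕ x ≡ᵇ toℕ i)

count₀-row : ∀ a b → count b₀ (row a b) ≡ a
count₀-row zero    zero    = refl
count₀-row zero    (suc b) = count₀-row zero b
count₀-row (suc a) b       = cong suc (count₀-row a b)

count₁-row : ∀ a b → count b₁ (row a b) ≡ b
count₁-row zero    zero    = refl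
count₁-row zero    (suc b) = cong suc (count₁-row zero b)
count₁-row (suc a) b       = count₁-row a b

count-entries₁ : ∀ i L → count i (entries (L ∷ [])) ≡ count i L
count-entries₁ i L = cong (count i) (++-identityʳ L)

count-entries₂ : ∀ i L₁ L₂ → count i (entries (L₁ ∷ L₂ ∷ [])) ≡ count i L₁ + count i L₂
count-entries₂ i L₁ L₂ = trans (countB-++ _ L₁ (L₂ ++ [])) (cong (count i L₁ +_) (count-entries₁ i L₂))

content⇒counts : ∀ {p q} T → contentT (p ∷ q ∷ []) T ≡ true →
  count b₀ (entries T) ≡ p × count b₁ (entries T) ≡ q
content⇒counts T h with ∧-true⁻ h
... | c₀ , c₁ = ≡ᵇ-true⇒≡ c₀ , ≡ᵇ-true⇒≡ (proj₁ (∧-true⁻ c₁))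

counts⇒content : ∀ {p q} T → count b₀ (entries T) ≡ p → count b₁ (entries T) ≡ q →
  contentT (p ∷ q ∷ []) T ≡ true
counts⇒content {p} {q} T refl refl = ∧-true⁺ (≡ᵇ-refl p) (∧-true⁺ (≡ᵇ-refl q) refl)

colStrict⇒ones : ∀ L₁ L₂ → colStrictB (L₁ ∷ L₂ ∷ []) ≡ true → length L₂ ≤ length L₁ →
  L₂ ≡ row 0 (length L₂)
colStrict⇒ones _         []        _  _         = refl
colStrict⇒ones (b₀ ∷ L₁) (b₁ ∷ L₂) h  (s≤s len) = cong (b₁ ∷_) (colStrict⇒ones L₁ L₂ h len)
colStrict⇒ones (b₀ ∷ L₁) (b₀ ∷ L₂) () _
colStrict⇒ones (b₁ ∷ L₁) (b₀ ∷ L₂) () _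
colStrict⇒ones (b₁ ∷ L₁) (b₁ ∷ L₂) () _

colStrict-row : ∀ a b r → r ≤ a → colStrictB (row a b ∷ row 0 r ∷ []) ≡ true
colStrict-row zero    zero    zero    _       = refl
colStrict-row zero    (suc b) zero    _       = refl
colStrict-row (suc a) b       zero    _       = refl
colStrict-row (suc a) b       (suc r) (s≤s r≤a) = colStrict-row a b r r≤a

colStrict-three-rows : ∀ (x₁ x₂ x₃ : Bit) L₁ L₂ L₃ T →
  colStrictB ((x₁ ∷ L₁) ∷ (x₂ ∷ L₂) ∷ (x₃ ∷ L₃) ∷ T) ≡ false
colStrict-three-rows b₀ b₀ _  _ _ _ _ = refl
colStrict-three-rows b₁ b₀ _  _ _ _ _ = refl
colStrict-three-rows b₁ b₁ _  _ _ _ _ = refl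
colStrict-three-rows b₀ b₁ b₀ _ _ _ _ = ∧-zeroʳ _
colStrict-three-rows b₀ b₁ b₁ _ _ _ _ = ∧-zeroʳ _

SSYT-oneRow⇒ : ∀ {p q} L → isSSYTB (p ∷ q ∷ []) (L ∷ []) ≡ true → L ≡ row p q
SSYT-oneRow⇒ L h with ∧-true⁻ h
... | weak , content with rowWeak⇒row L (proj₁ (∧-true⁻ weak)) | content⇒counts (L ∷ []) content
... | a , b , refl | c₀ , c₁ =
  cong₂ row (trans (sym (count₀-row a b)) (trans (sym (count-entries₁ b₀ (row a b))) c₀))
            (trans (sym (count₁-row a b)) (trans (sym (count-entries₁ b₁ (row a b))) c₁))

SSYT-oneRow : ∀ p q → isSSYTB (p ∷ q ∷ []) (row p q ∷ []) ≡ true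
SSYT-oneRow p q = ∧-true⁺ (∧-true⁺ (rowWeak-row p q) refl)
  (counts⇒content (row p q ∷ []) (trans (count-entries₁ b₀ (row p q)) (count₀-row p q))
                                 (trans (count-entries₁ b₁ (row p q)) (count₁-row p q)))

SSYT-twoRows⇒ : ∀ {p q r₁ r₂} L₁ L₂ → length L₁ ≡ r₁ → length L₂ ≡ r₂ → r₂ ≤ r₁ →
  isSSYTB (p ∷ q ∷ []) (L₁ ∷ L₂ ∷ []) ≡ true →
  r₂ ≤ q × L₁ ≡ row p (q ∸ r₂) × L₂ ≡ row 0 r₂
SSYT-twoRows⇒ {p} {q} L₁ L₂ refl refl len h with ∧-true⁻ h
... | weak , rest with ∧-true⁻ rest
... | strict , content
  with rowWeak⇒row L₁ (proj₁ (∧-true⁻ weak)) | colStrict⇒ones L₁ L₂ strict len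
... | a , b , refl | ones with content⇒counts (row a b ∷ L₂ ∷ []) content
... | c₀ , c₁ = r≤q , cong₂ row a≡p b≡q∸r , ones
  where
  r = length L₂
  open ≡-Reasoning
  count-rows : ∀ i → count i (entries (row a b ∷ L₂ ∷ [])) ≡ count i (row a b) + count i (row 0 r)
  count-rows i = trans (count-entries₂ i (row a b) L₂) (cong (λ L → count i (row a b) + count i L) ones)
  a≡p : a ≡ p
  a≡p = begin
    a                                         ≡⟨ sym (+-identityʳ a) ⟩
    a + 0                                     ≡⟨ sym (cong₂ _+_ (count₀-row a b) (count₀-row 0 r)) ⟩
    count b₀ (row a b) + count b₀ (row 0 r)   ≡⟨ sym (count-rows b₀) ⟩
    count b₀ (entries (row a b ∷ L₂ ∷ []))    ≡⟨ c₀ ⟩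
    p                                         ∎
  b+r≡q : b + r ≡ q
  b+r≡q = begin
    b + r                                     ≡⟨ sym (cong₂ _+_ (count₁-row a b) (count₁-row 0 r)) ⟩
    count b₁ (row a b) + count b₁ (row 0 r)   ≡⟨ sym (count-rows b₁) ⟩
    count b₁ (entries (row a b ∷ L₂ ∷ []))    ≡⟨ c₁ ⟩
    q                                         ∎
  r≤q : r ≤ q
  r≤q = subst (r ≤_) b+r≡q (m≤n+m r b)
  b≡q∸r : b ≡ q ∸ r
  b≡q∸r = sym (trans (cong (_∸ r) (sym b+r≡q)) (m+n∸n≡m b r))

SSYT-twoRows : ∀ {p q r} → r ≤ q → q ≤ p →
  isSSYTB (p ∷ q ∷ []) (row p (q ∸ r) ∷ row 0 r ∷ []) ≡ true
SSYT-twoRows {p} {q} {r} r≤q q≤p =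
  ∧-true⁺ (∧-true⁺ (rowWeak-row p (q ∸ r)) (∧-true⁺ (rowWeak-row 0 r) refl))
    (∧-true⁺ (colStrict-row p (q ∸ r) r (≤-trans r≤q q≤p))
             (counts⇒content (row p (q ∸ r) ∷ row 0 r ∷ []) c₀ c₁))
  where
  c₀ : count b₀ (entries (row p (q ∸ r) ∷ row 0 r ∷ [])) ≡ p
  c₀ = trans (count-entries₂ b₀ (row p (q ∸ r)) (row 0 r))
         (trans (cong₂ _+_ (count₀-row p (q ∸ r)) (count₀-row 0 r)) (+-identityʳ p))
  c₁ : count b₁ (entries (row p (q ∸ r) ∷ row 0 r ∷ [])) ≡ q
  c₁ = trans (count-entries₂ b₁ (row p (q ∸ r)) (row 0 r))
         (trans (cong₂ _+_ (count₁-row p (q ∸ r)) (count₁-row 0 r)) (m∸n+n≡m r≤q))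

kostka-oneRow : ∀ {r p q} → r ≡ p + q → kostka (r ∷ []) (p ∷ q ∷ []) ≡ 1
kostka-oneRow {r} {p} {q} r≡p+q =
  trans (countB-fillings-∷ r [] P)
    (sum-words-unique _ (row p q) (trans (length-row p q) (sym r≡p+q))
      (λ R → ⟦⟧≡0⊎ (P (Vec.toList R ∷ [])) (SSYT-oneRow⇒ (Vec.toList R)))
      (λ R e → cong ⟦_⟧ (subst (λ L → P (L ∷ []) ≡ true) (sym e) (SSYT-oneRow p q))))
  where
  P = isSSYTB (p ∷ q ∷ [])

kostka-twoRows : ∀ {r₁ r₂ p q} → r₂ ≤ r₁ → q ≤ p → r₁ + r₂ ≡ p + q →
  kostka (r₁ ∷ r₂ ∷ []) (p ∷ q ∷ []) ≡ ⟦ r₂ ≤ᵇ q ⟧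
kostka-twoRows {r₁} {r₂} {p} {q} r₂≤r₁ q≤p r₁+r₂≡p+q =
  trans (countB-fillings-∷ r₁ (r₂ ∷ []) P)
    (trans (cong sum (map-cong (λ R₁ → countB-fillings-∷ r₂ [] (P ∘ (Vec.toList R₁ ∷_)))
                               (words r₁)))
      (sum-completions (r₂ ≤? q)))
  where
  P = isSSYTB (p ∷ q ∷ [])
  completions : Vec Bit r₁ → ℕ
  completions R₁ = sum (map (λ R₂ → ⟦ P (Vec.toList R₁ ∷ Vec.toList R₂ ∷ []) ⟧) (words r₂))
  shape : ∀ R₁ R₂ → P (Vec.toList R₁ ∷ Vec.toList R₂ ∷ []) ≡ true →
    r₂ ≤ q × Vec.toList R₁ ≡ row p (q ∸ r₂) × Vec.toList R₂ ≡ row 0 r₂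
  shape R₁ R₂ = SSYT-twoRows⇒ _ _ (length-toList R₁) (length-toList R₂) r₂≤r₁
  sum-completions : Dec (r₂ ≤ q) → sum (map completions (words r₁)) ≡ ⟦ r₂ ≤ᵇ q ⟧
  sum-completions (no r₂≰q) = trans
    (sum-map-≡0 completions (words r₁) λ R₁ → sum-map-≡0 _ (words r₂) λ R₂ →
      ⟦⟧≡0 _ (r₂≰q ∘ proj₁ ∘ shape R₁ R₂))
    (sym (⟦≤ᵇ⟧≡0 r₂≰q))
  sum-completions (yes r₂≤q) = trans (sum-words-unique completions (row p (q ∸ r₂)) len off at-row)
                           (sym (⟦≤ᵇ⟧≡1 r₂≤q))
    where
    len : length (row p (q ∸ r₂)) ≡ r₁
    len = begin
      length (row p (q ∸ r₂))  ≡⟨ length-row p (q ∸ r₂) ⟩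
      p + (q ∸ r₂)             ≡⟨ +-∸-assoc p r₂≤q ⟨
      p + q ∸ r₂               ≡⟨ cong (_∸ r₂) r₁+r₂≡p+q ⟨
      r₁ + r₂ ∸ r₂             ≡⟨ m+n∸n≡m r₁ r₂ ⟩
      r₁                       ∎
      where open ≡-Reasoning
    off : ∀ R₁ → completions R₁ ≡ 0 ⊎ Vec.toList R₁ ≡ row p (q ∸ r₂)
    off R₁ with ≡-dec Fin._≟_ (Vec.toList R₁) (row p (q ∸ r₂))
    ... | yes R₁≡ = inj₂ R₁≡
    ... | no  R₁≢ = inj₁ (sum-map-≡0 _ (words r₂) λ R₂ →
                      ⟦⟧≡0 _ (R₁≢ ∘ proj₁ ∘ proj₂ ∘ shape R₁ R₂))
    at-row : ∀ R₁ → Vec.toList R₁ ≡ row p (q ∸ r₂) → completions R₁ ≡ 1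
    at-row R₁ R₁≡ = sum-words-unique _ (row 0 r₂) (length-row 0 r₂)
      (λ R₂ → ⟦⟧≡0⊎ _ (proj₂ ∘ proj₂ ∘ shape R₁ R₂))
      (λ R₂ R₂≡ → cong ⟦_⟧ (subst₂ (λ L₁ L₂ → P (L₁ ∷ L₂ ∷ []) ≡ true) (sym R₁≡) (sym R₂≡)
                                   (SSYT-twoRows r₂≤q q≤p)))

kostka-threeRows : ∀ {r₁ r₂ r₃ p q} μ → kostka (suc r₁ ∷ suc r₂ ∷ suc r₃ ∷ μ) (p ∷ q ∷ []) ≡ 0
kostka-threeRows {r₁} {r₂} {r₃} {p} {q} μ =
  trans (countB-fillings-∷ (suc r₁) (suc r₂ ∷ suc r₃ ∷ μ) P)
    (sum-map-≡0 _ (words (suc r₁)) λ R₁ →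
      trans (countB-fillings-∷ (suc r₂) (suc r₃ ∷ μ) (P ∘ (Vec.toList R₁ ∷_)))
    (sum-map-≡0 _ (words (suc r₂)) λ R₂ →
      trans (countB-fillings-∷ (suc r₃) μ (P ∘ (Vec.toList R₁ ∷_) ∘ (Vec.toList R₂ ∷_)))
    (sum-map-≡0 _ (words (suc r₃)) λ R₃ →
      countB-≡0 _ (fillings 2 μ) (column-clash R₁ R₂ R₃))))
  where
  P = isSSYTB (p ∷ q ∷ [])
  column-clash : ∀ (R₁ : Vec Bit (suc r₁)) (R₂ : Vec Bit (suc r₂)) (R₃ : Vec Bit (suc r₃)) T →
    P (Vec.toList R₁ ∷ Vec.toList R₂ ∷ Vec.toList R₃ ∷ T) ≡ false
  column-clash (x₁ ∷ R₁) (x₂ ∷ R₂) (x₃ ∷ R₃) T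
    rewrite colStrict-three-rows x₁ x₂ x₃ (Vec.toList R₁) (Vec.toList R₂) (Vec.toList R₃) T = ∧-zeroʳ _

twoLetterKostka : List ℕ → ℕ → ℕ
twoLetterKostka (r ∷ [])          q = 1
twoLetterKostka (r₁ ∷ r₂ ∷ [])    q = ⟦ r₂ ≤ᵇ q ⟧
twoLetterKostka _                 q = 0

kostka-twoLetters : ∀ {p q} μ → IsPartition μ → sum μ ≡ p + q → q ≤ p → 1 ≤ p →
  kostka μ (p ∷ q ∷ []) ≡ twoLetterKostka μ q
kostka-twoLetters [] _ () _ (s≤s z≤n)
kostka-twoLetters (r ∷ []) _ size _ _ = kostka-oneRow (trans (sym (+-identityʳ r)) size)
kostka-twoLetters (r₁ ∷ r₂ ∷ []) (_ , r₂≤r₁ ∷ _) size q≤p _ =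
  kostka-twoRows r₂≤r₁ q≤p (trans (cong (r₁ +_) (sym (+-identityʳ r₂))) size)
kostka-twoLetters {p} {q} (_ ∷ _ ∷ _ ∷ μ)
  (s≤s {n = r₁} z≤n ∷ s≤s {n = r₂} z≤n ∷ s≤s {n = r₃} z≤n ∷ _ , _) _ _ _ =
  kostka-threeRows {r₁} {r₂} {r₃} {p} {q} μ

secondRowIs : ℕ → List ℕ → Bool
secondRowIs q (r₁ ∷ r₂ ∷ []) = r₂ ≡ᵇ q
secondRowIs q _              = false

⟦<ᵇ-suc⟧ : ∀ m n → ⟦ m <ᵇ suc n ⟧ ≡ ⟦ m <ᵇ n ⟧ + ⟦ m ≡ᵇ n ⟧
⟦<ᵇ-suc⟧ zero    zero    = refl
⟦<ᵇ-suc⟧ zero    (suc n) = refl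
⟦<ᵇ-suc⟧ (suc m) zero    = refl
⟦<ᵇ-suc⟧ (suc m) (suc n) = ⟦<ᵇ-suc⟧ m n

twoLetterKostka-suc : ∀ μ q →
  twoLetterKostka μ (suc q) ≡ twoLetterKostka μ q + ⟦ secondRowIs (suc q) μ ⟧
twoLetterKostka-suc []                   q = refl
twoLetterKostka-suc (r ∷ [])             q = refl
twoLetterKostka-suc (r₁ ∷ zero ∷ [])     q = refl
twoLetterKostka-suc (r₁ ∷ suc r₂ ∷ [])   q = ⟦<ᵇ-suc⟧ r₂ q
twoLetterKostka-suc (_ ∷ _ ∷ _ ∷ _)      q = refl

-- Partitions

-- Linked _≥_ (m ∷ μ) says at once that μ is weakly decreasing and that its parts are at most m.
∈-parts⁻ : ∀ f n m {μ} → μ ∈ parts f n m → sum μ ≡ n × All (1 ≤_) μ × Linked _≥_ (m ∷ μ)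
∈-parts⁻ f       zero    m (here refl) = refl , [] , [-]
∈-parts⁻ f       zero    m (there ())
∈-parts⁻ zero    (suc n) m ()
∈-parts⁻ (suc f) (suc n) m μ∈
  with find (∈-concatMap⁻ (λ p → map (suc p ∷_) (parts f (n ∸ p) (suc p))) {xs = upTo (suc n ⊓ m)} μ∈)
... | p , p∈ , μ∈′ with ∈-map⁻ (suc p ∷_) μ∈′
... | μ′ , μ′∈ , refl with ∈-parts⁻ f (n ∸ p) (suc p) μ′∈
... | size , positive , linked =
  cong suc (trans (cong (p +_) size) (m+[n∸m]≡n (s≤s⁻¹ (≤-trans p< (m⊓n≤m (suc n) m))))) ,
  s≤s z≤n ∷ positive ,
  ≤-trans p< (m⊓n≤n (suc n) m) ∷ linked
  where
  p< : p < suc n ⊓ m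
  p< = ∈-upTo⁻ p∈

∈-parts⁺ : ∀ {f m μ} → All (1 ≤_) μ → Linked _≥_ (m ∷ μ) → sum μ ≤ f → μ ∈ parts f (sum μ) m
∈-parts⁺ {μ = []} [] _ _ = here refl
∈-parts⁺ {suc f} {m} {suc p ∷ μ} (s≤s z≤n ∷ positive) (p<m ∷ linked) (s≤s size≤f) =
  ∈-concatMap⁺ (λ i → map (suc i ∷_) (parts f (p + sum μ ∸ i) (suc i)))
    (lose (∈-upTo⁺ p<) (∈-map⁺ (suc p ∷_) μ∈))
  where
  p< : p < suc (p + sum μ) ⊓ m
  p< = ⊓-glb (s≤s (m≤m+n p (sum μ))) p<m
  μ∈ : μ ∈ parts f (p + sum μ ∸ p) (suc p)
  μ∈ = subst (λ n → μ ∈ parts f n (suc p)) (sym (m+n∸m≡n p (sum μ)))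
         (∈-parts⁺ positive linked (≤-trans (m≤n+m (sum μ) p) size≤f))

∈-partitions⁻ : ∀ d {μ} → μ ∈ partitions d → sum μ ≡ d × IsPartition μ
∈-partitions⁻ d μ∈ with ∈-parts⁻ d d d μ∈
... | size , positive , linked = size , positive , Linked.tail linked

∈-partitions⁺ : ∀ {μ} → IsPartition μ → μ ∈ partitions (sum μ)
∈-partitions⁺ {μ} (positive , linked) = ∈-parts⁺ positive (bounded linked) ≤-refl
  where
  bounded : ∀ {μ} → Linked _≥_ μ → Linked _≥_ (sum μ ∷ μ)
  bounded []              = [-]
  bounded {x ∷ μ} linked  = m≤m+n x (sum μ) ∷ linked

-- Schur coefficients

weightedSum : (A → ℤ) → (A → ℕ) → List A → ℤ
weightedSum c g xs = sumℤ (map (λ x → c x ℤ.* ℤ.+ g x) xs)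

weightedSum-cong : (c : A → ℤ) {g h : A → ℕ} (xs : List A) → (∀ x → x ∈ xs → g x ≡ h x) →
  weightedSum c g xs ≡ weightedSum c h xs
weightedSum-cong c []       _   = refl
weightedSum-cong c (x ∷ xs) g≡h =
  cong₂ ℤ._+_ (cong (λ n → c x ℤ.* ℤ.+ n) (g≡h x (here refl)))
              (weightedSum-cong c xs (λ y y∈ → g≡h y (there y∈)))

*-distribˡ-pos-+ : ∀ i m n → i ℤ.* ℤ.+ (m + n) ≡ i ℤ.* ℤ.+ m ℤ.+ i ℤ.* ℤ.+ n
*-distribˡ-pos-+ i m n = trans (cong (i ℤ.*_) (ℤ.pos-+ m n)) (ℤ.*-distribˡ-+ i (ℤ.+ m) (ℤ.+ n))

weightedSum-+ : (c : A → ℤ) (g h : A → ℕ) (xs : List A) →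
  weightedSum c (λ x → g x + h x) xs ≡ weightedSum c g xs ℤ.+ weightedSum c h xs
weightedSum-+ c g h []       = refl
weightedSum-+ c g h (x ∷ xs) =
  trans (cong₂ ℤ._+_ (*-distribˡ-pos-+ (c x) (g x) (h x)) (weightedSum-+ c g h xs))
        (interchange (c x ℤ.* ℤ.+ g x) (c x ℤ.* ℤ.+ h x) (weightedSum c g xs) (weightedSum c h xs))

weightedSum-supported : (c : A → ℤ) (g : A → ℕ) {a : A} (xs : List A) →
  (∀ x → x ∈ xs → g x ≡ 0 ⊎ x ≡ a) → weightedSum c g xs ≡ c a ℤ.* ℤ.+ sum (map g xs)
weightedSum-supported c g {a} []       _       = sym (ℤ.*-zeroʳ (c a))
weightedSum-supported c g {a} (x ∷ xs) support =
  trans (cong₂ ℤ._+_ head (weightedSum-supported c g xs (λ y y∈ → support y (there y∈))))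
        (sym (*-distribˡ-pos-+ (c a) (g x) (sum (map g xs))))
  where
  head : c x ℤ.* ℤ.+ g x ≡ c a ℤ.* ℤ.+ g x
  head with support x (here refl)
  ... | inj₁ gx≡0 rewrite gx≡0 = trans (ℤ.*-zeroʳ (c x)) (sym (ℤ.*-zeroʳ (c a)))
  ... | inj₂ refl = refl

weightedSum-extract : (c : A → ℤ) (g : A → ℕ) {a : A} (xs : List A) →
  (∀ x → x ∈ xs → g x ≡ 0 ⊎ x ≡ a) → a ∈ xs → 1 ≤ g a → weightedSum c g xs ≡ 0ℤ → c a ≡ 0ℤ
weightedSum-extract c g {a} xs support a∈ 1≤ga sum≡0 =
  [ id , (λ S≡0 → contradiction (ℤ.+-injective S≡0) (n>0⇒n≢0 S>0)) ]′
    (ℤ.i*j≡0⇒i≡0∨j≡0 (c a) (trans (sym (weightedSum-supported c g xs support)) sum≡0))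
  where
  S>0 : 1 ≤ sum (map g xs)
  S>0 = ≤-trans 1≤ga (∈⇒≤sum (∈-map⁺ g a∈))

module _ (f : List ℕ → ℕ) (c : List ℕ → ℤ) (expansion : IsSchurExpansion f c)
         (vanishes : ∀ a → length a ≤ 2 → f a ≡ 0) where

  twoLetterSum≡0 : ∀ {p q d} → q ≤ p → 1 ≤ p → sum (p ∷ q ∷ []) ≡ d →
    weightedSum c (λ μ → twoLetterKostka μ q) (partitions d) ≡ 0ℤ
  twoLetterSum≡0 {p} {q} q≤p 1≤p refl =
    trans (weightedSum-cong c (partitions (sum (p ∷ q ∷ []))) kostka≡)
          (sym (trans (cong ℤ.+_ (sym (vanishes (p ∷ q ∷ []) (s≤s (s≤s z≤n)))))
                      (expansion (p ∷ q ∷ []))))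
    where
    kostka≡ : ∀ μ → μ ∈ partitions (sum (p ∷ q ∷ [])) → twoLetterKostka μ q ≡ kostka μ (p ∷ q ∷ [])
    kostka≡ μ μ∈ with ∈-partitions⁻ (sum (p ∷ q ∷ [])) μ∈
    ... | size , partition =
      sym (kostka-twoLetters μ partition (trans size (cong (p +_) (+-identityʳ q))) q≤p 1≤p)

  coeff-empty≡0 : c [] ≡ 0ℤ
  coeff-empty≡0 = sym (begin
    0ℤ                     ≡⟨ cong ℤ.+_ (sym (vanishes [] z≤n)) ⟩
    ℤ.+ f []               ≡⟨ expansion [] ⟩
    c [] ℤ.* ℤ.+ 1 ℤ.+ 0ℤ  ≡⟨ ℤ.+-identityʳ _ ⟩
    c [] ℤ.* ℤ.+ 1         ≡⟨ ℤ.*-identityʳ (c []) ⟩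
    c []                   ∎)
    where open ≡-Reasoning

  coeff-oneRow≡0 : ∀ k → c (suc k ∷ []) ≡ 0ℤ
  coeff-oneRow≡0 k =
    weightedSum-extract c (λ μ → twoLetterKostka μ 0) (partitions (suc k + 0)) support
      (∈-partitions⁺ {suc k ∷ []} (s≤s z≤n ∷ [] , [-])) ≤-refl
      (twoLetterSum≡0 {suc k} z≤n (s≤s z≤n) refl)
    where
    support : ∀ μ → μ ∈ partitions (suc k + 0) → twoLetterKostka μ 0 ≡ 0 ⊎ μ ≡ suc k ∷ []
    support []                  _  = inj₁ refl
    support (r ∷ [])            μ∈ =
      inj₂ (cong (_∷ []) (+-cancelʳ-≡ 0 r (suc k) (proj₁ (∈-partitions⁻ (suc k + 0) μ∈))))
    support (r₁ ∷ suc r₂ ∷ [])  _  = inj₁ refl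
    support (r₁ ∷ zero ∷ [])    μ∈ with ∈-partitions⁻ (suc k + 0) μ∈
    ... | _ , (_ ∷ () ∷ _) , _
    support (_ ∷ _ ∷ _ ∷ _)     _  = inj₁ refl

  coeff-twoRows≡0 : ∀ {p j} → j ≤ p → c (suc p ∷ suc j ∷ []) ≡ 0ℤ
  coeff-twoRows≡0 {p} {j} j≤p =
    weightedSum-extract c second (partitions d) support
      (∈-partitions⁺ {suc p ∷ suc j ∷ []} (s≤s z≤n ∷ s≤s z≤n ∷ [] , s≤s j≤p ∷ [-]))
      (≤-reflexive (sym (cong ⟦_⟧ (≡ᵇ-refl j)))) second-sum≡0
    where
    d = sum (suc p ∷ suc j ∷ [])
    second : List ℕ → ℕ
    second μ = ⟦ secondRowIs (suc j) μ ⟧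
    W : (List ℕ → ℕ) → ℤ
    W g = weightedSum c g (partitions d)
    second-sum≡0 : W second ≡ 0ℤ
    second-sum≡0 = begin
      W second                                    ≡⟨ ℤ.+-identityˡ _ ⟨
      0ℤ ℤ.+ W second                             ≡⟨ cong (ℤ._+ W second) shifted-sum≡0 ⟨
      W (λ μ → twoLetterKostka μ j) ℤ.+ W second  ≡⟨ weightedSum-+ c _ second (partitions d) ⟨
      W (λ μ → twoLetterKostka μ j + second μ)
        ≡⟨ weightedSum-cong c (partitions d) (λ μ _ → sym (twoLetterKostka-suc μ j)) ⟩
      W (λ μ → twoLetterKostka μ (suc j))         ≡⟨ twoLetterSum≡0 {suc p} (s≤s j≤p) (s≤s z≤n) refl ⟩
      0ℤ                                          ∎
      where
      open ≡-Reasoning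
      shifted-sum≡0 : W (λ μ → twoLetterKostka μ j) ≡ 0ℤ
      shifted-sum≡0 = twoLetterSum≡0 {suc (suc p)} (m≤n⇒m≤1+n (m≤n⇒m≤1+n j≤p)) (s≤s z≤n)
                                     (cong suc (sym (+-suc p (j + 0))))
    support : ∀ μ → μ ∈ partitions d → second μ ≡ 0 ⊎ μ ≡ suc p ∷ suc j ∷ []
    support []              _  = inj₁ refl
    support (_ ∷ [])        _  = inj₁ refl
    support (_ ∷ _ ∷ _ ∷ _) _  = inj₁ refl
    support (r₁ ∷ r₂ ∷ [])  μ∈ = ⟦⟧≡0⊎ (r₂ ≡ᵇ suc j) λ e → shape (≡ᵇ-true⇒≡ e)
      where
      shape : r₂ ≡ suc j → r₁ ∷ r₂ ∷ [] ≡ suc p ∷ suc j ∷ []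
      shape refl = cong (_∷ suc j ∷ []) (+-cancelʳ-≡ (suc j + 0) r₁ (suc p) (proj₁ (∈-partitions⁻ d μ∈)))

  coeff-atMostTwoRows≡0 : ∀ lam → IsPartition lam → length lam ≤ 2 → c lam ≡ 0ℤ
  coeff-atMostTwoRows≡0 []              _                                       _ = coeff-empty≡0
  coeff-atMostTwoRows≡0 (_ ∷ [])        (s≤s z≤n ∷ [] , _)                      _ = coeff-oneRow≡0 _
  coeff-atMostTwoRows≡0 (_ ∷ _ ∷ [])    (s≤s z≤n ∷ s≤s z≤n ∷ [] , s≤s j≤p ∷ _) _ = coeff-twoRows≡0 j≤p
  coeff-atMostTwoRows≡0 (_ ∷ _ ∷ _ ∷ _) _                        (s≤s (s≤s ()))

corollary2p8 : ∀ {n : ℕ} (G : SimpleGraph n) (α : Fin n → ℕ) →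
    Σ (Fin n) (λ u → Σ (Fin n) (λ v → (Adj G u v ≡ true) × (3 ≤ α u + α v))) →
    (c : List ℕ → ℤ) → IsSchurExpansion (coeffX G α) c →
    ∀ (lam : List ℕ) → IsPartition lam → length lam ≤ 2 → c lam ≡ 0ℤ
corollary2p8 G α (u , v , adj , 3≤αu+αv) c expansion =
  coeff-atMostTwoRows≡0 (coeffX G α) c expansion
    (λ a a≤2 → coeffX-vanishes G α adj a (<-≤-trans (s≤s a≤2) 3≤αu+αv))
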